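{- Let $s,t\in\mathbb N$. Then the set of the four corner vertices $F=\{(1,1),(s,1),(1,t),(s,t)\}$ is a frame for the grid $G_{s,t}$.
   Context: The grid $G_{s,t}$ has vertex set $[s]\times[t]$ and edges $(i,j)(i',j')$ with $|i-i'|+|j-j'|=1$. An endomorphism of a graph $G$ is a map $h:V(G)\to V(G)$ with $h(u)h(v)\in E(G)$ for all $uv\in E(G)$. A set $F\subseteq V(G)$ is a frame for $G$ if every endomorphism $h$ of $G$ with $F\subseteq h(V(G))$ is surjective. -}

module Defs where

open import Data.Nat using (ℕ; suc; _+_)
open import Data.Nat.Base using (∣_-_∣)
open import Data.Fin using (Fin; toℕ; zero; fromℕ)
open import Data.Product using (_×_; _,_; ∃)
open import Relation.Binary.PropositionalEquality using (_≡_)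

-- Vertex set of the grid G_{m,n} with m = suc s, n = suc t rows/columns:
-- Fin (suc s) × Fin (suc t), i.e. [s+1] × [t+1] shifted to 0-indexing.
GridV : ℕ → ℕ → Set
GridV m n = Fin m × Fin n

GridAdj : ∀ {m n} → GridV m n → GridV m n → Set
GridAdj (i , j) (i' , j') = ∣ toℕ i - toℕ i' ∣ + ∣ toℕ j - toℕ j' ∣ ≡ 1

IsEndo : ∀ {m n} → (GridV m n → GridV m n) → Set
IsEndo {m} {n} h = ∀ (u v : GridV m n) → GridAdj u v → GridAdj (h u) (h v)

InImage : ∀ {m n} → (GridV m n → GridV m n) → GridV m n → Set
InImage h y = ∃ λ x → h x ≡ y

Surj : ∀ {m n} → (GridV m n → GridV m n) → Set
Surj {m} {n} h = ∀ (y : GridV m n) → InImage h y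

IsFrame : ∀ {m n} → (GridV m n → Set) → Set
IsFrame {m} {n} F = ∀ (h : GridV m n → GridV m n) → IsEndo h →
  (∀ y → F y → InImage h y) → Surj h

data Corner (s t : ℕ) : GridV (suc s) (suc t) → Set where
  c11 : Corner s t (zero , zero)
  cs1 : Corner s t (fromℕ s , zero)
  c1t : Corner s t (zero , fromℕ t)
  cst : Corner s t (fromℕ s , fromℕ t)

-- An endomorphism h of the grid is 1-Lipschitz for the grid distance
-- d((i,j),(i',j')) = ∣i-i'∣ + ∣j-j'∣, which is the graph distance. If the four
-- corners are hit, pick preimages a, b, c, d of the corners (0,0), (s,0), (0,t),
-- (s,t). Since h brings the pairs {a,d} and {b,c} to diametral pairs, they are
-- diametral pairs of corners themselves, and as d(x,u) + d(x,w) = s + t for any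
-- diametral pair {u,w}, the inequalities d(hx,hu) ≤ d(x,u) are all equalities:
-- d(hx,(0,0)) = d(x,a) and d(hx,(s,0)) = d(x,b). A grid point is determined by
-- its distances to (0,0) and (s,0), and reflecting the grid so that a goes to
-- (0,0) (followed by a transposition if b does not go to (s,0)) produces, for
-- every y, a point x with d(x,a) = d(y,(0,0)) and d(x,b) = d(y,(s,0)); then hx = y.
module Submission where

open import Defs
open import Data.Nat using (ℕ; zero; suc; _+_; _∸_; _≤_; z≤n; s≤s)
open import Data.Nat.Base using (∣_-_∣)
open import Data.Nat.Properties
open import Data.Fin using (Fin; toℕ; fromℕ) renaming (zero to fzero; suc to fsuc)
open import Data.Fin.Properties using (toℕ-injective; toℕ-fromℕ; toℕ≤pred[n])
open import Data.Product using (_×_; _,_; proj₁; proj₂)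
open import Data.Sum using (_⊎_; inj₁; inj₂)
open import Relation.Binary.PropositionalEquality
open import Algebra.Properties.CommutativeSemigroup +-commutativeSemigroup using (interchange)

m≤o⇒n≤p⇒m+n≡o+p⇒m≡o : ∀ {m n o p} → m ≤ o → n ≤ p → m + n ≡ o + p → m ≡ o
m≤o⇒n≤p⇒m+n≡o+p⇒m≡o {m} {n} {o} {p} m≤o n≤p eq =
  ≤-antisym m≤o (+-cancelʳ-≤ n o m (≤-trans (+-monoʳ-≤ o n≤p) (≤-reflexive (sym eq))))

m+m≡n+n⇒m≡n : ∀ {m n} → m + m ≡ n + n → m ≡ n
m+m≡n+n⇒m≡n {m} {n} eq with ≤-total m n
... | inj₁ m≤n = m≤o⇒n≤p⇒m+n≡o+p⇒m≡o m≤n m≤n eq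
... | inj₂ n≤m = sym (m≤o⇒n≤p⇒m+n≡o+p⇒m≡o n≤m n≤m (sym eq))

∣m-n∣≤o : ∀ {m n o} → m ≤ o → n ≤ o → ∣ m - n ∣ ≤ o
∣m-n∣≤o {m} {n} m≤o n≤o = ≤-trans (∣m-n∣≤m⊔n m n) (⊔-lub m≤o n≤o)

IsEnd : ℕ → ℕ → Set
IsEnd n a = a ≡ 0 ⊎ a ≡ n

isEnd⇒≤ : ∀ {n a} → IsEnd n a → a ≤ n
isEnd⇒≤ (inj₁ refl) = z≤n
isEnd⇒≤ (inj₂ refl) = ≤-refl

∣a-b∣≡n⇒isEnd : ∀ {n a b} → ∣ a - b ∣ ≡ n → a ≤ n → b ≤ n → IsEnd n a
∣a-b∣≡n⇒isEnd {n} {a} {b} eq a≤n b≤n with ≤-total a b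
... | inj₂ b≤a =
  inj₂ (≤-antisym a≤n (subst (_≤ a) (trans (sym (m≤n⇒∣n-m∣≡n∸m b≤a)) eq) (m∸n≤m a b)))
... | inj₁ a≤b = inj₁ (n≤0⇒n≡0 (+-cancelʳ-≤ n a 0 (≤-trans (≤-reflexive a+n≡b) b≤n)))
  where
  a+n≡b : a + n ≡ b
  a+n≡b = trans (cong (a +_) (trans (sym eq) (m≤n⇒∣m-n∣≡n∸m a≤b))) (m+[n∸m]≡n a≤b)

isEnd-∣-∣ : ∀ {n a b} → IsEnd n a → IsEnd n b → IsEnd n ∣ a - b ∣
isEnd-∣-∣     (inj₁ refl) (inj₁ refl) = inj₁ refl
isEnd-∣-∣     (inj₁ refl) (inj₂ refl) = inj₂ refl
isEnd-∣-∣ {n} (inj₂ refl) (inj₁ refl) = inj₂ (∣-∣-identityʳ n)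
isEnd-∣-∣ {n} (inj₂ refl) (inj₂ refl) = inj₁ (∣n-n∣≡0 n)

-- x ↦ ∣ x - a ∣ is the reflection of [0, n] exchanging the end a with 0.
∣∣x-a∣-a∣≡x : ∀ {n a x} → IsEnd n a → x ≤ n → ∣ ∣ x - a ∣ - a ∣ ≡ x
∣∣x-a∣-a∣≡x {x = x} (inj₁ refl) _ = trans (∣-∣-identityʳ _) (∣-∣-identityʳ x)
∣∣x-a∣-a∣≡x {n} {x = x} (inj₂ refl) x≤n = begin
  ∣ ∣ x - n ∣ - n ∣ ≡⟨ cong (λ y → ∣ y - n ∣) (m≤n⇒∣m-n∣≡n∸m x≤n) ⟩
  ∣ n ∸ x - n ∣     ≡⟨ m≤n⇒∣m-n∣≡n∸m (m∸n≤m n x) ⟩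
  n ∸ (n ∸ x)       ≡⟨ m∸[m∸n]≡n x≤n ⟩
  x                 ∎
  where open ≡-Reasoning

∣x-b∣≡∣∣x-a∣-∣a-b∣∣ : ∀ {n a b x} → IsEnd n a → IsEnd n b → x ≤ n →
                      ∣ x - b ∣ ≡ ∣ ∣ x - a ∣ - ∣ a - b ∣ ∣
∣x-b∣≡∣∣x-a∣-∣a-b∣∣             (inj₁ refl) (inj₁ refl) _   = sym (∣-∣-identityʳ _)
∣x-b∣≡∣∣x-a∣-∣a-b∣∣ {n} {x = x} (inj₁ refl) (inj₂ refl) _   =
  cong (λ y → ∣ y - n ∣) (sym (∣-∣-identityʳ x))
∣x-b∣≡∣∣x-a∣-∣a-b∣∣ {n} {x = x} (inj₂ refl) (inj₁ refl) x≤n = trans (∣-∣-identityʳ x)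
  (sym (trans (cong (λ y → ∣ ∣ x - n ∣ - y ∣) (∣-∣-identityʳ n)) (∣∣x-a∣-a∣≡x (inj₂ refl) x≤n)))
∣x-b∣≡∣∣x-a∣-∣a-b∣∣ {n} {x = x} (inj₂ refl) (inj₂ refl) _   =
  sym (trans (cong (λ y → ∣ ∣ x - n ∣ - y ∣) (∣n-n∣≡0 n)) (∣-∣-identityʳ _))

∣x-a∣+∣x-b∣≡∣a-b∣ : ∀ {n a b x} → ∣ a - b ∣ ≡ n → a ≤ n → b ≤ n → x ≤ n →
                    ∣ x - a ∣ + ∣ x - b ∣ ≡ n
∣x-a∣+∣x-b∣≡∣a-b∣ {n} {a} {b} {x} eq a≤n b≤n x≤n = begin
  ∣ x - a ∣ + ∣ x - b ∣                 ≡⟨ cong (∣ x - a ∣ +_) (∣x-b∣≡∣∣x-a∣-∣a-b∣∣ a-end b-end x≤n) ⟩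
  ∣ x - a ∣ + ∣ ∣ x - a ∣ - ∣ a - b ∣ ∣ ≡⟨ cong (λ y → ∣ x - a ∣ + ∣ ∣ x - a ∣ - y ∣) eq ⟩
  ∣ x - a ∣ + ∣ ∣ x - a ∣ - n ∣         ≡⟨ cong (∣ x - a ∣ +_) (m≤n⇒∣m-n∣≡n∸m ∣x-a∣≤n) ⟩
  ∣ x - a ∣ + (n ∸ ∣ x - a ∣)           ≡⟨ m+[n∸m]≡n ∣x-a∣≤n ⟩
  n                                     ∎
  where
  open ≡-Reasoning
  a-end = ∣a-b∣≡n⇒isEnd eq a≤n b≤n
  b-end = ∣a-b∣≡n⇒isEnd (trans (∣-∣-comm b a) eq) b≤n a≤n
  ∣x-a∣≤n = ∣m-n∣≤o x≤n a≤n

isEnd-+-≡ : ∀ {s t δ₁ δ₂} → IsEnd s δ₁ → IsEnd t δ₂ → δ₁ + δ₂ ≡ s →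
            (δ₁ ≡ s × δ₂ ≡ 0) ⊎ (δ₁ ≡ 0 × δ₂ ≡ t × t ≡ s)
isEnd-+-≡         (inj₁ refl) (inj₁ refl) eq = inj₁ (eq , refl)
isEnd-+-≡         (inj₁ refl) (inj₂ refl) eq = inj₂ (refl , refl , eq)
isEnd-+-≡         (inj₂ refl) (inj₁ refl) eq = inj₁ (refl , refl)
isEnd-+-≡ {s} {t} (inj₂ refl) (inj₂ refl) eq =
  inj₁ (refl , +-cancelˡ-≡ s t 0 (trans eq (sym (+-identityʳ s))))

clamp : (n : ℕ) → ℕ → Fin (suc n)
clamp n       zero    = fzero
clamp zero    (suc k) = fzero
clamp (suc n) (suc k) = fsuc (clamp n k)

toℕ-clamp : ∀ n k → k ≤ n → toℕ (clamp n k) ≡ k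
toℕ-clamp n       zero    _         = refl
toℕ-clamp (suc n) (suc k) (s≤s k≤n) = cong suc (toℕ-clamp n k k≤n)

clamp-toℕ : ∀ n (i : Fin (suc n)) → clamp n (toℕ i) ≡ i
clamp-toℕ n i = toℕ-injective (toℕ-clamp n (toℕ i) (toℕ≤pred[n] i))

clamp-suc : ∀ n k → clamp n (suc k) ≡ clamp n k ⊎ toℕ (clamp n (suc k)) ≡ suc (toℕ (clamp n k))
clamp-suc zero    zero    = inj₁ refl
clamp-suc zero    (suc k) = inj₁ refl
clamp-suc (suc n) zero    = inj₂ refl
clamp-suc (suc n) (suc k) with clamp-suc n k
... | inj₁ eq = inj₁ (cong fsuc eq)
... | inj₂ eq = inj₂ (cong suc eq)

reflect : (n a x : ℕ) → Fin (suc n)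
reflect n a x = clamp n ∣ x - a ∣

∣reflect-b∣ : ∀ {n a b x} → IsEnd n a → IsEnd n b → x ≤ n →
              ∣ toℕ (reflect n a x) - b ∣ ≡ ∣ x - ∣ a - b ∣ ∣
∣reflect-b∣ {n} {a} {b} {x} a-end b-end x≤n = begin
  ∣ toℕ (clamp n ∣ x - a ∣) - b ∣         ≡⟨ cong (λ y → ∣ y - b ∣) (toℕ-clamp n _ ∣x-a∣≤n) ⟩
  ∣ ∣ x - a ∣ - b ∣                       ≡⟨ ∣x-b∣≡∣∣x-a∣-∣a-b∣∣ a-end b-end ∣x-a∣≤n ⟩
  ∣ ∣ ∣ x - a ∣ - a ∣ - ∣ a - b ∣ ∣       ≡⟨ cong (λ y → ∣ y - ∣ a - b ∣ ∣) (∣∣x-a∣-a∣≡x a-end x≤n) ⟩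
  ∣ x - ∣ a - b ∣ ∣                       ∎
  where
  open ≡-Reasoning
  ∣x-a∣≤n = ∣m-n∣≤o x≤n (isEnd⇒≤ a-end)

dist : ∀ {m n} → GridV m n → GridV m n → ℕ
dist (i , j) (i′ , j′) = ∣ toℕ i - toℕ i′ ∣ + ∣ toℕ j - toℕ j′ ∣

module _ {m n : ℕ} where

  dist-self : (u : GridV m n) → dist u u ≡ 0
  dist-self (i , j) = cong₂ _+_ (∣n-n∣≡0 (toℕ i)) (∣n-n∣≡0 (toℕ j))

  dist-comm : (u v : GridV m n) → dist u v ≡ dist v u
  dist-comm (i , j) (i′ , j′) = cong₂ _+_ (∣-∣-comm (toℕ i) (toℕ i′)) (∣-∣-comm (toℕ j) (toℕ j′))

  dist-triangle : (u v w : GridV m n) → dist u w ≤ dist u v + dist v w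
  dist-triangle (i , j) (i′ , j′) (i″ , j″) = ≤-trans
    (+-mono-≤ (∣-∣-triangle (toℕ i) (toℕ i′) (toℕ i″)) (∣-∣-triangle (toℕ j) (toℕ j′) (toℕ j″)))
    (≤-reflexive (interchange ∣ toℕ i - toℕ i′ ∣ ∣ toℕ i′ - toℕ i″ ∣ ∣ toℕ j - toℕ j′ ∣ ∣ toℕ j′ - toℕ j″ ∣))

  row-adjacent : ∀ {i i′ : Fin m} (j : Fin n) → toℕ i′ ≡ suc (toℕ i) → GridAdj (i , j) (i′ , j)
  row-adjacent {i} j eq = cong₂ _+_
    (trans (cong (λ x → ∣ toℕ i - x ∣) eq) (trans (m≤n⇒∣m-n∣≡n∸m (n≤1+n (toℕ i))) (m+n∸n≡m 1 (toℕ i))))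
    (∣n-n∣≡0 (toℕ j))

  column-adjacent : ∀ (i : Fin m) {j j′ : Fin n} → toℕ j′ ≡ suc (toℕ j) → GridAdj (i , j) (i , j′)
  column-adjacent i {j} eq = cong₂ _+_ (∣n-n∣≡0 (toℕ i))
    (trans (cong (λ x → ∣ toℕ j - x ∣) eq) (trans (m≤n⇒∣m-n∣≡n∸m (n≤1+n (toℕ j))) (m+n∸n≡m 1 (toℕ j))))

  walk-dist : (f : ℕ → GridV m n) → (∀ k → dist (f k) (f (suc k)) ≤ 1) →
              ∀ a k → dist (f a) (f (k + a)) ≤ k
  walk-dist f step a zero    = ≤-reflexive (dist-self (f a))
  walk-dist f step a (suc k) = ≤-trans (dist-triangle (f a) (f (k + a)) (f (suc k + a)))
    (≤-trans (+-mono-≤ (walk-dist f step a k) (step (k + a))) (≤-reflexive (+-comm k 1)))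

  walk-lipschitz : (f : ℕ → GridV m n) → (∀ k → dist (f k) (f (suc k)) ≤ 1) →
                   ∀ a b → dist (f a) (f b) ≤ ∣ a - b ∣
  walk-lipschitz f step a b with ≤-total a b
  ... | inj₁ a≤b = subst₂ (λ c d → dist (f a) (f c) ≤ d) (m∸n+n≡m a≤b) (sym (m≤n⇒∣m-n∣≡n∸m a≤b))
                          (walk-dist f step a (b ∸ a))
  ... | inj₂ b≤a = subst₂ _≤_ (dist-comm (f b) (f a)) (sym (m≤n⇒∣n-m∣≡n∸m b≤a))
                          (subst (λ c → dist (f b) (f c) ≤ a ∸ b) (m∸n+n≡m b≤a)
                                 (walk-dist f step b (a ∸ b)))

  path-lipschitz : ∀ {k} (g : Fin (suc k) → GridV m n) →
                   (∀ i i′ → toℕ i′ ≡ suc (toℕ i) → GridAdj (g i) (g i′)) →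
                   ∀ i i′ → dist (g i) (g i′) ≤ ∣ toℕ i - toℕ i′ ∣
  path-lipschitz {k} g adjacent i i′ =
    subst₂ (λ x y → dist (g x) (g y) ≤ ∣ toℕ i - toℕ i′ ∣) (clamp-toℕ k i) (clamp-toℕ k i′)
      (walk-lipschitz (λ j → g (clamp k j)) step (toℕ i) (toℕ i′))
    where
    step : ∀ j → dist (g (clamp k j)) (g (clamp k (suc j))) ≤ 1
    step j with clamp-suc k j
    ... | inj₁ eq = subst (λ x → dist (g (clamp k j)) (g x) ≤ 1) (sym eq)
                          (≤-trans (≤-reflexive (dist-self (g (clamp k j)))) z≤n)
    ... | inj₂ eq = ≤-reflexive (adjacent _ _ eq)

NonExpanding : ∀ {m n} → (GridV m n → GridV m n) → Set
NonExpanding h = ∀ u v → dist (h u) (h v) ≤ dist u v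

endo⇒nonExpanding : ∀ {s t} (h : GridV (suc s) (suc t) → GridV (suc s) (suc t)) →
                    IsEndo h → NonExpanding h
endo⇒nonExpanding h endo (i , j) (i′ , j′) =
  ≤-trans (dist-triangle (h (i , j)) (h (i′ , j)) (h (i′ , j′)))
    (+-mono-≤ (path-lipschitz (λ x → h (x , j)) (λ _ _ eq → endo _ _ (row-adjacent j eq)) i i′)
              (path-lipschitz (λ y → h (i′ , y)) (λ _ _ eq → endo _ _ (column-adjacent i′ eq)) j j′))

module _ {s t : ℕ} where

  private
    V : Set
    V = GridV (suc s) (suc t)

  corner₀₀ corner₁₀ corner₀₁ corner₁₁ : V
  corner₀₀ = fzero  , fzero
  corner₁₀ = fromℕ s , fzero
  corner₀₁ = fzero  , fromℕ t
  corner₁₁ = fromℕ s , fromℕ t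

  IsCorner : V → Set
  IsCorner (i , j) = IsEnd s (toℕ i) × IsEnd t (toℕ j)

  Diametral : V → V → Set
  Diametral u v = dist u v ≡ s + t

  dist≤s+t : (u v : V) → dist u v ≤ s + t
  dist≤s+t (i , j) (i′ , j′) =
    +-mono-≤ (∣m-n∣≤o (toℕ≤pred[n] i) (toℕ≤pred[n] i′)) (∣m-n∣≤o (toℕ≤pred[n] j) (toℕ≤pred[n] j′))

  diametral⇒∣-∣ : ∀ {i i′ j j′} → Diametral (i , j) (i′ , j′) →
                  ∣ toℕ i - toℕ i′ ∣ ≡ s × ∣ toℕ j - toℕ j′ ∣ ≡ t
  diametral⇒∣-∣ {i} {i′} {j} {j′} eq =
    first , +-cancelˡ-≡ s _ _ (trans (cong (_+ ∣ toℕ j - toℕ j′ ∣) (sym first)) eq)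
    where
    first : ∣ toℕ i - toℕ i′ ∣ ≡ s
    first = m≤o⇒n≤p⇒m+n≡o+p⇒m≡o (∣m-n∣≤o (toℕ≤pred[n] i) (toℕ≤pred[n] i′))
                                 (∣m-n∣≤o (toℕ≤pred[n] j) (toℕ≤pred[n] j′)) eq

  diametral⇒isCorner : ∀ {u v} → Diametral u v → IsCorner u
  diametral⇒isCorner {i , j} {i′ , j′} eq with diametral⇒∣-∣ {i} {i′} {j} {j′} eq
  ... | e₁ , e₂ = ∣a-b∣≡n⇒isEnd e₁ (toℕ≤pred[n] i) (toℕ≤pred[n] i′) ,
                  ∣a-b∣≡n⇒isEnd e₂ (toℕ≤pred[n] j) (toℕ≤pred[n] j′)

  diametral⇒dist-sum : ∀ {u v} → Diametral u v → ∀ x → dist x u + dist x v ≡ s + t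
  diametral⇒dist-sum {i , j} {i′ , j′} eq (x , y) with diametral⇒∣-∣ {i} {i′} {j} {j′} eq
  ... | e₁ , e₂ = trans
    (interchange ∣ toℕ x - toℕ i ∣ ∣ toℕ y - toℕ j ∣ ∣ toℕ x - toℕ i′ ∣ ∣ toℕ y - toℕ j′ ∣)
    (cong₂ _+_ (∣x-a∣+∣x-b∣≡∣a-b∣ e₁ (toℕ≤pred[n] i) (toℕ≤pred[n] i′) (toℕ≤pred[n] x))
               (∣x-a∣+∣x-b∣≡∣a-b∣ e₂ (toℕ≤pred[n] j) (toℕ≤pred[n] j′) (toℕ≤pred[n] y)))

  module _ (h : V → V) (nonExpanding : NonExpanding h) (u v : V) (diam : Diametral (h u) (h v)) where

    diametral-preimage : Diametral u v
    diametral-preimage = ≤-antisym (dist≤s+t u v) (subst (_≤ dist u v) diam (nonExpanding u v))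

    -- d(hx,hu) + d(hx,hv) = s + t = d(x,u) + d(x,v), and each summand can only shrink.
    dist-to-diametral-preserved : ∀ x → dist (h x) (h u) ≡ dist x u
    dist-to-diametral-preserved x = m≤o⇒n≤p⇒m+n≡o+p⇒m≡o (nonExpanding x u) (nonExpanding x v)
      (trans (diametral⇒dist-sum diam (h x)) (sym (diametral⇒dist-sum diametral-preimage x)))

  dist-corner₀₀+dist-corner₁₀ : ∀ (i : Fin (suc s)) (j : Fin (suc t)) →
    dist (i , j) corner₀₀ + dist (i , j) corner₁₀ ≡ s + (∣ toℕ j - 0 ∣ + ∣ toℕ j - 0 ∣)
  dist-corner₀₀+dist-corner₁₀ i j = trans
    (interchange ∣ toℕ i - 0 ∣ ∣ toℕ j - 0 ∣ ∣ toℕ i - toℕ (fromℕ s) ∣ ∣ toℕ j - 0 ∣)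
    (cong (_+ (∣ toℕ j - 0 ∣ + ∣ toℕ j - 0 ∣))
          (∣x-a∣+∣x-b∣≡∣a-b∣ (toℕ-fromℕ s) z≤n (≤-reflexive (toℕ-fromℕ s)) (toℕ≤pred[n] i)))

  -- The second coordinate is read off d(u,(0,0)) + d(u,(s,0)) = s + 2 u₂, the first off d(u,(0,0)).
  dist-corner₀₀-corner₁₀-injective : ∀ u v → dist u corner₀₀ ≡ dist v corner₀₀ →
                                     dist u corner₁₀ ≡ dist v corner₁₀ → u ≡ v
  dist-corner₀₀-corner₁₀-injective (i , j) (i′ , j′) eq₀₀ eq₁₀ =
    cong₂ _,_ (toℕ-injective (strip i-eq)) (toℕ-injective (strip j-eq))
    where
    strip : ∀ {x y} → ∣ x - 0 ∣ ≡ ∣ y - 0 ∣ → x ≡ y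
    strip {x} {y} = subst₂ _≡_ (∣-∣-identityʳ x) (∣-∣-identityʳ y)
    j-eq : ∣ toℕ j - 0 ∣ ≡ ∣ toℕ j′ - 0 ∣
    j-eq = m+m≡n+n⇒m≡n (+-cancelˡ-≡ s _ _ (trans (sym (dist-corner₀₀+dist-corner₁₀ i j))
             (trans (cong₂ _+_ eq₀₀ eq₁₀) (dist-corner₀₀+dist-corner₁₀ i′ j′))))
    i-eq : ∣ toℕ i - 0 ∣ ≡ ∣ toℕ i′ - 0 ∣
    i-eq = +-cancelʳ-≡ ∣ toℕ j - 0 ∣ _ _ (trans eq₀₀ (cong (∣ toℕ i′ - 0 ∣ +_) (sym j-eq)))

  -- The point at offsets (x, y) from the corner a, i.e. the image of (x, y) under the
  -- symmetry of the grid taking (0,0) to a.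
  reflectAt : V → ℕ → ℕ → V
  reflectAt a x y = reflect s (toℕ (proj₁ a)) x , reflect t (toℕ (proj₂ a)) y

  dist-reflectAt : ∀ {a b x y} → IsCorner a → IsCorner b → x ≤ s → y ≤ t →
    dist (reflectAt a x y) b ≡
    ∣ x - ∣ toℕ (proj₁ a) - toℕ (proj₁ b) ∣ ∣ + ∣ y - ∣ toℕ (proj₂ a) - toℕ (proj₂ b) ∣ ∣
  dist-reflectAt (a₁ , a₂) (b₁ , b₂) x≤s y≤t = cong₂ _+_ (∣reflect-b∣ a₁ b₁ x≤s) (∣reflect-b∣ a₂ b₂ y≤t)

  diametral-corner₀₀-corner₁₁ : Diametral corner₀₀ corner₁₁
  diametral-corner₀₀-corner₁₁ = cong₂ _+_ (toℕ-fromℕ s) (toℕ-fromℕ t)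

  diametral-corner₁₀-corner₀₁ : Diametral corner₁₀ corner₀₁
  diametral-corner₁₀-corner₀₁ = cong₂ _+_ (trans (∣-∣-identityʳ _) (toℕ-fromℕ s)) (toℕ-fromℕ t)

  module _ (h : V → V) (nonExpanding : NonExpanding h) {a b c d : V}
           (ha : h a ≡ corner₀₀) (hb : h b ≡ corner₁₀) (hc : h c ≡ corner₀₁) (hd : h d ≡ corner₁₁) where

    private
      diametral-ad : Diametral (h a) (h d)
      diametral-ad = subst₂ Diametral (sym ha) (sym hd) diametral-corner₀₀-corner₁₁

      diametral-bc : Diametral (h b) (h c)
      diametral-bc = subst₂ Diametral (sym hb) (sym hc) diametral-corner₁₀-corner₀₁

      a-corner : IsCorner a
      a-corner = diametral⇒isCorner (diametral-preimage h nonExpanding a d diametral-ad)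

      b-corner : IsCorner b
      b-corner = diametral⇒isCorner (diametral-preimage h nonExpanding b c diametral-bc)

      dist-to-corner₀₀ : ∀ x → dist (h x) corner₀₀ ≡ dist x a
      dist-to-corner₀₀ x =
        subst (λ z → dist (h x) z ≡ dist x a) ha
              (dist-to-diametral-preserved h nonExpanding a d diametral-ad x)

      dist-to-corner₁₀ : ∀ x → dist (h x) corner₁₀ ≡ dist x b
      dist-to-corner₁₀ x =
        subst (λ z → dist (h x) z ≡ dist x b) hb
              (dist-to-diametral-preserved h nonExpanding b c diametral-bc x)

      δ₁ δ₂ : ℕ
      δ₁ = ∣ toℕ (proj₁ a) - toℕ (proj₁ b) ∣
      δ₂ = ∣ toℕ (proj₂ a) - toℕ (proj₂ b) ∣

      δ₁+δ₂≡s : δ₁ + δ₂ ≡ s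
      δ₁+δ₂≡s = trans (sym (dist-to-corner₁₀ a))
        (trans (cong (λ z → dist z corner₁₀) ha) (trans (+-identityʳ _) (toℕ-fromℕ s)))

      image-of-reflectAt : ∀ {x y} → x ≤ s → y ≤ t →
        dist (h (reflectAt a x y)) corner₀₀ ≡ ∣ x - 0 ∣ + ∣ y - 0 ∣ ×
        dist (h (reflectAt a x y)) corner₁₀ ≡ ∣ x - δ₁ ∣ + ∣ y - δ₂ ∣
      image-of-reflectAt {x} {y} x≤s y≤t =
        trans (dist-to-corner₀₀ _) (trans (dist-reflectAt a-corner a-corner x≤s y≤t)
          (cong₂ (λ u v → ∣ x - u ∣ + ∣ y - v ∣) (∣n-n∣≡0 (toℕ (proj₁ a))) (∣n-n∣≡0 (toℕ (proj₂ a))))) ,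
        trans (dist-to-corner₁₀ _) (dist-reflectAt a-corner b-corner x≤s y≤t)

    corners-in-image⇒surjective : Surj h
    corners-in-image⇒surjective (p , q)
      with isEnd-+-≡ (isEnd-∣-∣ (proj₁ a-corner) (proj₁ b-corner))
                     (isEnd-∣-∣ (proj₂ a-corner) (proj₂ b-corner)) δ₁+δ₂≡s
    ... | inj₁ (δ₁≡s , δ₂≡0) = reflectAt a (toℕ p) (toℕ q) ,
      dist-corner₀₀-corner₁₀-injective _ (p , q) to₀₀
        (trans to₁₀ (cong₂ (λ u v → ∣ toℕ p - u ∣ + ∣ toℕ q - v ∣)
                           (trans δ₁≡s (sym (toℕ-fromℕ s))) δ₂≡0))
      where
      images = image-of-reflectAt (toℕ≤pred[n] p) (toℕ≤pred[n] q)
      to₀₀ = proj₁ images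
      to₁₀ = proj₂ images
    -- Relative to a, the point b is the corner (0, s) and s = t, so the grid is also transposed.
    ... | inj₂ (δ₁≡0 , δ₂≡t , t≡s) = reflectAt a (toℕ q) (toℕ p) ,
      dist-corner₀₀-corner₁₀-injective _ (p , q) (trans to₀₀ (+-comm ∣ toℕ q - 0 ∣ ∣ toℕ p - 0 ∣))
        (trans to₁₀ (trans (cong₂ (λ u v → ∣ toℕ q - u ∣ + ∣ toℕ p - v ∣)
                                  δ₁≡0 (trans δ₂≡t (trans t≡s (sym (toℕ-fromℕ s)))))
                           (+-comm ∣ toℕ q - 0 ∣ _)))
      where
      images = image-of-reflectAt (subst (toℕ q ≤_) t≡s (toℕ≤pred[n] q))
                                  (subst (toℕ p ≤_) (sym t≡s) (toℕ≤pred[n] p))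
      to₀₀ = proj₁ images
      to₁₀ = proj₂ images

lemma5p3 : (s t : ℕ) → IsFrame {suc s} {suc t} (Corner s t)
lemma5p3 s t h endo hits = corners-in-image⇒surjective h (endo⇒nonExpanding h endo)
  (proj₂ (hits _ c11)) (proj₂ (hits _ cs1)) (proj₂ (hits _ c1t)) (proj₂ (hits _ cst))
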